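{- Let $k\geq 1$, let $G_i=(V_i,E_i)$ for $1\le i\le k$ and $H=(V_H,E_H)$ be pairwise vertex-disjoint, connected graphs, each with at least two vertices, let $u_i\in V_i$ for $i=1,\dots,k$, and let $v_1,\dots,v_k\in V_H$ (not necessarily distinct). Let $J=(V_J,E_J)$ be the composed graph $G_{1,\ldots,k}\circ^{u_1,\dots,u_k}_{v_1,\dots,v_k}H$. Then for two distinct vertices $w_1,w_2\in V_J$, $\{w_1,w_2\}$ is an edge of the strong resolving graph $\mathrm{SR}(J)$ if and only if $w_1,w_2\notin\{v_1,\dots,v_k\}$ and one of the following holds: (1) $w_1,w_2\in V_i$ for some $i$, $1\le i\le k$, and $w_1,w_2$ are mutually maximally distant in $G_i$; (2) $w_1,w_2\in V_H$ and $w_1,w_2$ are mutually maximally distant in $H$; (3) $w_1\in V_i$ and $w_2\in V_j$ for some $1\le i<j\le k$, $w_1$ is maximally distant from $u_i$ in $G_i$ and $w_2$ is maximally distant from $u_j$ in $G_j$; or (4) $w_1\in V_i$ for some $i$, $1\le i\le k$, $w_2\in V_H$, $w_1$ is maximally distant from $u_i$ in $G_i$ and $w_2$ is maximally distant from $v_i$ in $H$.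
   Context: All graphs are finite, undirected and simple. In a connected graph $G$, $d_G(x,y)$ is the distance and $N_G(x)$ the set of neighbours of $x$. A vertex $u$ is maximally distant from a vertex $w$ in $G$ if there is no $v\in N_G(u)$ with $d_G(v,w)>d_G(u,w)$. Two vertices are mutually maximally distant if each is maximally distant from the other. The strong resolving graph $\mathrm{SR}(G)$ has the same vertex set as $G$, with an edge between distinct $u,v$ iff $u,v$ are mutually maximally distant in $G$. The composed graph $J=G_{1,\ldots,k}\circ^{u_1,\dots,u_k}_{v_1,\dots,v_k}H$ has vertex set $(V_1\cup\dots\cup V_k\cup V_H)\setminus\{u_1,\dots,u_k\}$ and edge set $(E_1\cup\dots\cup E_k\cup E_H\cup\{\{x,v_i\}: x\in N_{G_i}(u_i),1\le i\le k\})\setminus\{\{x,u_i\}: x\in N_{G_i}(u_i),1\le i\le k\}$; i.e. $J$ is obtained from the disjoint union by identifying each $u_i$ with $v_i$. -}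

module Defs where

open import Data.Nat using (ℕ; zero; suc; _≤_; _<_)
open import Data.Fin using (Fin)
import Data.Fin
open import Data.Unit using (⊤)
open import Data.Product using (Σ; ∃; _×_; _,_)
open import Data.Sum using (_⊎_; inj₁; inj₂)
open import Relation.Nullary using (¬_)
open import Relation.Binary.PropositionalEquality using (_≡_; _≢_)
open import Function.Bundles using (_⇔_)

record Graph (V : Set) : Set₁ where
  field
    Adj    : V → V → Set
    sym    : ∀ {x y} → Adj x y → Adj y x
    irrefl : ∀ {x} → ¬ Adj x x
open Graph public

module _ {V : Set} (G : Graph V) where

  data Walk : V → V → ℕ → Set where
    here : ∀ {x} → Walk x x 0
    step : ∀ {x y z m} → Adj G x y → Walk y z m → Walk x z (suc m)

  Connected : Set
  Connected = ∀ x y → ∃ λ m → Walk x y m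

  IsDist : V → V → ℕ → Set
  IsDist x y d = Walk x y d × (∀ {m} → Walk x y m → d ≤ m)

  MaxDistFrom : V → V → Set
  MaxDistFrom u w = ∀ v → Adj G u v → ∀ {a b} → IsDist v w a → IsDist u w b → ¬ (b < a)

  MutMaxDist : V → V → Set
  MutMaxDist x y = MaxDistFrom x y × MaxDistFrom y x

  SREdge : V → V → Set
  SREdge x y = x ≢ y × MutMaxDist x y

-- Composed graph  G_{1..k} ∘^{u_1..u_k}_{v_1..v_k} H
-- G_i lives on Fin (n i), H on Fin m.  The vertex set of J is the disjoint
-- union of the V_i \ {u_i} and V_H (u_i identified with v_i).

record GVert {k : ℕ} (n : Fin k → ℕ) (u : (i : Fin k) → Fin (n i)) : Set where
  constructor gv
  field
    comp : Fin k
    vert : Fin (n comp)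
    .ne  : vert ≢ u comp

VJ : {k : ℕ} (n : Fin k → ℕ) (u : (i : Fin k) → Fin (n i)) (m : ℕ) → Set
VJ n u m = GVert n u ⊎ Fin m

module Compose {k m : ℕ} {n : Fin k → ℕ}
               (G : (i : Fin k) → Graph (Fin (n i))) (H : Graph (Fin m))
               (u : (i : Fin k) → Fin (n i)) (v : Fin k → Fin m) where

  data AdjJ : VJ n u m → VJ n u m → Set where
    gg : ∀ {i x y} .{px py} → Adj (G i) x y →
         AdjJ (inj₁ (gv i x px)) (inj₁ (gv i y py))
    hh : ∀ {a b} → Adj H a b → AdjJ (inj₂ a) (inj₂ b)
    gh : ∀ {i x} .{px} → Adj (G i) x (u i) →
         AdjJ (inj₁ (gv i x px)) (inj₂ (v i))
    hg : ∀ {i x} .{px} → Adj (G i) (u i) x →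
         AdjJ (inj₂ (v i)) (inj₁ (gv i x px))

  private
    symJ : ∀ {x y} → AdjJ x y → AdjJ y x
    symJ (gg e) = gg (sym (G _) e)
    symJ (hh e) = hh (sym H e)
    symJ (gh e) = hg (sym (G _) e)
    symJ (hg e) = gh (sym (G _) e)

    irreflJ : ∀ {x} → ¬ AdjJ x x
    irreflJ (gg e) = irrefl (G _) e
    irreflJ (hh e) = irrefl H e

  J : Graph (VJ n u m)
  J = record { Adj = AdjJ ; sym = symJ ; irrefl = irreflJ }

  NotV : VJ n u m → Set
  NotV (inj₁ _) = ⊤
  NotV (inj₂ a) = ∀ i → a ≢ v i

  data Cond : VJ n u m → VJ n u m → Set where
    c1 : ∀ {i x y} .{px py} → MutMaxDist (G i) x y →
         Cond (inj₁ (gv i x px)) (inj₁ (gv i y py))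
    c2 : ∀ {a b} → MutMaxDist H a b → Cond (inj₂ a) (inj₂ b)
    c3 : ∀ {i j x y} .{px py} → Data.Fin._<_ i j →
         MaxDistFrom (G i) x (u i) → MaxDistFrom (G j) y (u j) →
         Cond (inj₁ (gv i x px)) (inj₁ (gv j y py))
    c4 : ∀ {i x b} .{px} → MaxDistFrom (G i) x (u i) → MaxDistFrom H b (v i) →
         Cond (inj₁ (gv i x px)) (inj₂ b)

{-# OPTIONS --safe #-}
module Submission where

-- Each factor G_i meets the rest of J only in the cut vertex u_i = v_i, so a shortest path
-- from x ∈ V_i to a vertex t outside V_i runs through v_i and d_J(x,t) = d_{G_i}(x,u_i) + d_J(v_i,t);
-- inside one factor distances are unchanged.  Hence every distance d_J(·,t) that matters for
-- maximal distance is, on the neighbourhood of a vertex, a fixed shift of a distance in a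
-- factor, and maximal distance transfers between J and the factor.  The vertices v_i
-- themselves are never maximally distant: from v_i one can always step further into G_i,
-- or further into H towards the far side of G_i.

open import Defs
open import Data.Nat using (ℕ; zero; suc; _+_; _≤_; _<_; z≤n; s≤s; _≤?_)
open import Data.Nat.Properties
  using (≤-antisym; ≤-trans; ≰⇒>; n<1+n; n≤1+n; +-comm; +-suc; m≤m+n; m<n+m; +-mono-≤;
         +-monoʳ-<; +-cancelˡ-<)
open import Data.Fin using (Fin) renaming (zero to fzero; suc to fsuc)
open import Data.Fin.Properties using (_≟_; <-cmp; <⇒≢)
open import Data.Unit using (tt)
open import Data.Product using (_×_; _,_; Σ; ∃; proj₁; proj₂; swap)
open import Data.Sum using (_⊎_; inj₁; inj₂)
open import Data.Empty using (⊥-elim)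
import Data.Empty.Irrelevant as Irrelevant
open import Relation.Nullary using (¬_; yes; no)
open import Relation.Binary using (tri<; tri≈; tri>)
open import Relation.Binary.PropositionalEquality
  using (_≡_; _≢_; refl; subst; subst₂; ≢-sym) renaming (sym to ≡-sym)
open import Function.Bundles using (_⇔_; mk⇔; Equivalence)

open Equivalence using (to; from)

module Walks {V : Set} (K : Graph V) where

  append : ∀ {x y z a b} → Walk K x y a → Walk K y z b → Walk K x z (a + b)
  append here       w′ = w′
  append (step e w) w′ = step e (append w w′)

  reverse : ∀ {x y a} → Walk K x y a → Walk K y x a
  reverse here = here
  reverse {a = suc a} (step e w) =
    subst (Walk K _ _) (+-comm a 1) (append (reverse w) (step (sym K e) here))

  IsDist-sym : ∀ {x y d} → IsDist K x y d → IsDist K y x d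
  IsDist-sym (w , shortest) = reverse w , λ w′ → shortest (reverse w′)

  IsDist-unique : ∀ {x y a b} → IsDist K x y a → IsDist K x y b → a ≡ b
  IsDist-unique (wa , la) (wb , lb) = ≤-antisym (la wb) (lb wa)

  IsDist-refl : ∀ {x} → IsDist K x x 0
  IsDist-refl = here , λ _ → z≤n

  IsDist-pos : ∀ {x y d} → x ≢ y → IsDist K x y d → 0 < d
  IsDist-pos {d = zero}  x≢y (here , _) = ⊥-elim (x≢y refl)
  IsDist-pos {d = suc d} _   _          = s≤s z≤n

  Adj⇒≢ : ∀ {x y} → Adj K x y → y ≢ x
  Adj⇒≢ e refl = irrefl K e

  -- Without a decision procedure for walk lengths only the double negation is available;
  -- it suffices, since every use concludes ⊥.
  Walk⇒¬¬IsDist : ∀ {x y l} → Walk K x y l → ¬ ¬ ∃ (IsDist K x y)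
  Walk⇒¬¬IsDist {x} {y} {l} w noDist = noWalkBelow (suc l) (n<1+n l) w
    where
    noWalkBelow : ∀ N {a} → a < N → ¬ Walk K x y a
    noWalkBelow (suc N) {a} (s≤s a≤N) wa = noDist (a , wa , shortest)
      where
      shortest : ∀ {b} → Walk K x y b → a ≤ b
      shortest {b} wb with a ≤? b
      ... | yes a≤b = a≤b
      ... | no a≰b  = ⊥-elim (noWalkBelow N (≤-trans (≰⇒> a≰b) a≤N) wb)

  Connected⇒¬¬IsDist : Connected K → ∀ x y → ¬ ¬ ∃ (IsDist K x y)
  Connected⇒¬¬IsDist conn x y = Walk⇒¬¬IsDist (proj₂ (conn x y))

  ¬¬-MaxDistFrom : ∀ {x y} → ¬ ¬ MaxDistFrom K x y → MaxDistFrom K x y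
  ¬¬-MaxDistFrom ¬¬M z e dz dx lt = ¬¬M λ M → M z e dz dx lt

  Walk⇒neighbour : ∀ {x y l} → x ≢ y → Walk K x y l → ∃ (Adj K x)
  Walk⇒neighbour x≢y here       = ⊥-elim (x≢y refl)
  Walk⇒neighbour _   (step e _) = _ , e

open Walks

Fin-other : ∀ {N} → 2 ≤ N → (x : Fin N) → ∃ (x ≢_)
Fin-other (s≤s (s≤s _)) fzero    = fsuc fzero , λ ()
Fin-other (s≤s (s≤s _)) (fsuc _) = fzero , λ ()

Connected⇒neighbour : ∀ {N} (K : Graph (Fin N)) → 2 ≤ N → Connected K → ∀ x → ∃ (Adj K x)
Connected⇒neighbour K 2≤N conn x with Fin-other 2≤N x
... | y , x≢y = Walk⇒neighbour K x≢y (proj₂ (conn x y))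

module MaxDistTransfer {A B : Set} (K : Graph A) (L : Graph B) (f : A → B)
                       {y : A} {t : B} (c : ℕ)
                       (shift : ∀ {z d} → IsDist K z y d → IsDist L (f z) t (c + d)) where

  MaxDistFrom-reflect : ∀ {x} → (∀ {z} → Adj K x z → Adj L (f x) (f z)) →
                        MaxDistFrom L (f x) t → MaxDistFrom K x y
  MaxDistFrom-reflect hom M z e dz dx lt =
    M (f z) (hom e) (shift dz) (shift dx) (+-monoʳ-< c lt)

  MaxDistFrom-preserve : ∀ {x} → (∀ z → ¬ ¬ ∃ (IsDist K z y)) →
                         (∀ {z} → Adj L (f x) z → ∃ λ z′ → Adj K x z′ × z ≡ f z′) →
                         MaxDistFrom K x y → MaxDistFrom L (f x) t
  MaxDistFrom-preserve {x} dist neighbour M z e dz dx lt with neighbour e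
  ... | z′ , e′ , refl =
    dist z′ λ (a , da) → dist x λ (b , db) →
    M z′ e′ da db (+-cancelˡ-< c b a
      (subst₂ _<_ (IsDist-unique L dx (shift db)) (IsDist-unique L dz (shift da)) lt))

open MaxDistTransfer

module Composition {k m : ℕ} {n : Fin k → ℕ}
  (G : (i : Fin k) → Graph (Fin (n i))) (H : Graph (Fin m))
  (u : (i : Fin k) → Fin (n i)) (v : Fin k → Fin m) where

  open Compose G H u v

  V : Set
  V = VJ n u m

  embed : (i : Fin k) → Fin (n i) → V
  embed i x with x ≟ u i
  ... | yes _   = inj₂ (v i)
  ... | no x≢uᵢ = inj₁ (gv i x x≢uᵢ)

  proj : (i : Fin k) → V → Fin (n i)
  proj i (inj₁ (gv j x _)) with j ≟ i
  ... | yes refl = x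
  ... | no _     = u i
  proj i (inj₂ _) = u i

  collapse : (i : Fin k) → V → V
  collapse i (inj₁ (gv j x p)) with j ≟ i
  ... | yes _ = inj₂ (v i)
  ... | no _  = inj₁ (gv j x p)
  collapse i (inj₂ a) = inj₂ a

  projH : V → Fin m
  projH (inj₁ (gv j _ _)) = v j
  projH (inj₂ a)          = a

  embed-gv : ∀ i x .(p : x ≢ u i) → embed i x ≡ inj₁ (gv i x p)
  embed-gv i x p with x ≟ u i
  ... | yes x≡uᵢ = Irrelevant.⊥-elim (p x≡uᵢ)
  ... | no _     = refl

  embed-u : ∀ i → embed i (u i) ≡ inj₂ (v i)
  embed-u i with u i ≟ u i
  ... | yes _ = refl
  ... | no ≢  = ⊥-elim (≢ refl)

  proj-gv : ∀ i x .(p : x ≢ u i) → proj i (inj₁ (gv i x p)) ≡ x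
  proj-gv i x p with i ≟ i
  ... | yes refl = refl
  ... | no ≢     = ⊥-elim (≢ refl)

  collapse-gv : ∀ i x .(p : x ≢ u i) → collapse i (inj₁ (gv i x p)) ≡ inj₂ (v i)
  collapse-gv i x p with i ≟ i
  ... | yes _ = refl
  ... | no ≢  = ⊥-elim (≢ refl)

  proj-embed : ∀ i x → proj i (embed i x) ≡ x
  proj-embed i x with x ≟ u i
  ... | yes x≡uᵢ = ≡-sym x≡uᵢ
  ... | no x≢uᵢ  = proj-gv i x x≢uᵢ

  collapse-embed : ∀ i x → collapse i (embed i x) ≡ inj₂ (v i)
  collapse-embed i x with x ≟ u i
  ... | yes _   = refl
  ... | no x≢uᵢ = collapse-gv i x x≢uᵢ

  Outside : Fin k → V → Set
  Outside i t = proj i t ≡ u i × collapse i t ≡ t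

  Outside-H : ∀ i b → Outside i (inj₂ b)
  Outside-H i b = refl , refl

  Outside-gv : ∀ i j y .(p : y ≢ u j) → j ≢ i → Outside i (inj₁ (gv j y p))
  Outside-gv i j y p j≢i with j ≟ i
  ... | yes j≡i = ⊥-elim (j≢i j≡i)
  ... | no _    = refl , refl

  Adj-split : ∀ i {s t} → AdjJ s t →
    (Adj (G i) (proj i s) (proj i t) × collapse i s ≡ collapse i t) ⊎
    (proj i s ≡ proj i t × AdjJ (collapse i s) (collapse i t))
  Adj-split i (gg {j} e) with j ≟ i
  ... | yes refl = inj₁ (e , refl)
  ... | no _     = inj₂ (refl , gg e)
  Adj-split i (hh e) = inj₂ (refl , hh e)
  Adj-split i (gh {j} e) with j ≟ i
  ... | yes refl = inj₁ (e , refl)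
  ... | no _     = inj₂ (refl , gh e)
  Adj-split i (hg {j} e) with j ≟ i
  ... | yes refl = inj₁ (e , refl)
  ... | no _     = inj₂ (refl , hg e)

  Walk-split : ∀ i {s t l} → Walk J s t l →
    Σ ℕ λ a → Σ ℕ λ b → Walk (G i) (proj i s) (proj i t) a ×
                         Walk J (collapse i s) (collapse i t) b × a + b ≤ l
  Walk-split i here = 0 , 0 , here , here , z≤n
  Walk-split i {l = suc l} (step e w) with Walk-split i w | Adj-split i e
  ... | a , b , wG , wJ , a+b≤l | inj₁ (eG , eq) =
    suc a , b , step eG wG , subst (λ s → Walk J s _ b) (≡-sym eq) wJ , s≤s a+b≤l
  ... | a , b , wG , wJ , a+b≤l | inj₂ (eq , eJ) =
    a , suc b , subst (λ s → Walk (G i) s _ a) (≡-sym eq) wG , step eJ wJ ,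
    subst (_≤ suc l) (≡-sym (+-suc a b)) (s≤s a+b≤l)

  Adj-projH : ∀ {s t} → AdjJ s t → Adj H (projH s) (projH t) ⊎ projH s ≡ projH t
  Adj-projH (gg _) = inj₂ refl
  Adj-projH (hh e) = inj₁ e
  Adj-projH (gh _) = inj₂ refl
  Adj-projH (hg _) = inj₂ refl

  Walk-projH : ∀ {s t l} → Walk J s t l → Σ ℕ λ b → Walk H (projH s) (projH t) b × b ≤ l
  Walk-projH here = 0 , here , z≤n
  Walk-projH (step e w) with Walk-projH w | Adj-projH e
  ... | b , wH , b≤l | inj₁ eH = suc b , step eH wH , s≤s b≤l
  ... | b , wH , b≤l | inj₂ eq =
    b , subst (λ s → Walk H s _ b) (≡-sym eq) wH , ≤-trans b≤l (n≤1+n _)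

  Adj-embed : ∀ i {x y} → Adj (G i) x y → AdjJ (embed i x) (embed i y)
  Adj-embed i {x} {y} e with x ≟ u i | y ≟ u i
  ... | yes refl | yes refl = ⊥-elim (irrefl (G i) e)
  ... | yes refl | no _     = hg e
  ... | no _     | yes refl = gh e
  ... | no _     | no _     = gg e

  Walk-embed : ∀ i {x y l} → Walk (G i) x y l → Walk J (embed i x) (embed i y) l
  Walk-embed i here       = here
  Walk-embed i (step e w) = step (Adj-embed i e) (Walk-embed i w)

  Walk-embedH : ∀ {a b l} → Walk H a b l → Walk J (inj₂ a) (inj₂ b) l
  Walk-embedH here       = here
  Walk-embedH (step e w) = step (hh e) (Walk-embedH w)

  IsDist-embed : ∀ i {x y d} → IsDist (G i) x y d → IsDist J (embed i x) (embed i y) d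
  IsDist-embed i {x} {y} (w , shortest) = Walk-embed i w , shortest′
    where
    shortest′ : ∀ {l} → Walk J (embed i x) (embed i y) l → _ ≤ l
    shortest′ w′ with Walk-split i w′
    ... | a , b , wG , _ , a+b≤l =
      ≤-trans (shortest (subst₂ (λ p q → Walk (G i) p q a) (proj-embed i x) (proj-embed i y) wG))
              (≤-trans (m≤m+n a b) a+b≤l)

  IsDist-embedH : ∀ {a b d} → IsDist H a b d → IsDist J (inj₂ a) (inj₂ b) d
  IsDist-embedH (w , shortest) = Walk-embedH w , λ w′ →
    let _ , wH , b≤l = Walk-projH w′ in ≤-trans (shortest wH) b≤l

  IsDist-cut : ∀ i {x t d₁ d₂} → Outside i t →
               IsDist (G i) x (u i) d₁ → IsDist J (inj₂ (v i)) t d₂ →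
               IsDist J (embed i x) t (d₁ + d₂)
  IsDist-cut i {x} {t} (proj≡u , collapse≡t) (w₁ , shortest₁) (w₂ , shortest₂) =
    append J (subst (λ s → Walk J (embed i x) s _) (embed-u i) (Walk-embed i w₁)) w₂ , shortest
    where
    shortest : ∀ {l} → Walk J (embed i x) t l → _ ≤ l
    shortest w with Walk-split i w
    ... | a , b , wG , wJ , a+b≤l =
      ≤-trans (+-mono-≤ (shortest₁ (subst₂ (λ p q → Walk (G i) p q a) (proj-embed i x) proj≡u wG))
                        (shortest₂ (subst₂ (λ p q → Walk J p q b) (collapse-embed i x) collapse≡t wJ)))
              a+b≤l

  IsDist-cutH : ∀ j {y c d₁ d₂} → IsDist (G j) y (u j) d₁ → IsDist H c (v j) d₂ →
                IsDist J (inj₂ c) (embed j y) (d₁ + d₂)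
  IsDist-cutH j {c = c} dG dH =
    IsDist-sym J (IsDist-cut j (Outside-H j c) dG (IsDist-embedH (IsDist-sym H dH)))

  neighbour-gv : ∀ {i x z} .{p} → AdjJ (inj₁ (gv i x p)) z →
                 ∃ λ y → Adj (G i) x y × z ≡ embed i y
  neighbour-gv (gg {y = y} {py = py} e) = y , e , ≡-sym (embed-gv _ y py)
  neighbour-gv (gh e)                   = _ , e , ≡-sym (embed-u _)

  neighbour-embed : ∀ i x .(p : x ≢ u i) → ∀ {z} → AdjJ (embed i x) z →
                    ∃ λ y → Adj (G i) x y × z ≡ embed i y
  neighbour-embed i x p e = neighbour-gv (subst (λ s → AdjJ s _) (embed-gv i x p) e)

  neighbour-H : ∀ {a z} → NotV (inj₂ a) → AdjJ (inj₂ a) z → ∃ λ c → Adj H a c × z ≡ inj₂ c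
  neighbour-H _    (hh e)     = _ , e , refl
  neighbour-H notV (hg {i} _) = ⊥-elim (notV i refl)

  module ConnectedFactors (conn-G : ∀ i → Connected (G i)) (conn-H : Connected H) where

    Walk-toH : (s : V) → ∃ λ l → Walk J s (inj₂ (projH s)) l
    Walk-toH (inj₂ a) = 0 , here
    Walk-toH (inj₁ (gv i x p)) =
      let l , w = conn-G i x (u i) in
      l , subst₂ (λ s s′ → Walk J s s′ l) (embed-gv i x p) (embed-u i) (Walk-embed i w)

    J-connected : Connected J
    J-connected s t =
      let _ , w₁ = Walk-toH s
          _ , w₂ = Walk-toH t
          _ , w  = conn-H (projH s) (projH t)
      in _ , append J w₁ (append J (Walk-embedH w) (reverse J w₂))

    distG : ∀ i x y → ¬ ¬ ∃ (IsDist (G i) x y)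
    distG i = Connected⇒¬¬IsDist (G i) (conn-G i)

    distH : ∀ a b → ¬ ¬ ∃ (IsDist H a b)
    distH = Connected⇒¬¬IsDist H conn-H

    distJ : ∀ s t → ¬ ¬ ∃ (IsDist J s t)
    distJ = Connected⇒¬¬IsDist J J-connected

    MaxDistFrom-G-G : ∀ i {x y} .{p q} →
      MaxDistFrom J (inj₁ (gv i x p)) (inj₁ (gv i y q)) ⇔ MaxDistFrom (G i) x y
    MaxDistFrom-G-G i {x} {y} {p} {q} =
      subst₂ (λ s s′ → MaxDistFrom J s s′ ⇔ _) (embed-gv i x p) (embed-gv i y q)
        (mk⇔ (MaxDistFrom-reflect (G i) J (embed i) 0 (IsDist-embed i) (Adj-embed i))
             (MaxDistFrom-preserve (G i) J (embed i) 0 (IsDist-embed i)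
                                   (λ z → distG i z y) (neighbour-embed i x p)))

    MaxDistFrom-G-outside : ∀ i {x t} .{p} → Outside i t →
      MaxDistFrom J (inj₁ (gv i x p)) t ⇔ MaxDistFrom (G i) x (u i)
    MaxDistFrom-G-outside i {x} {t} {p} out =
      subst (λ s → MaxDistFrom J s t ⇔ _) (embed-gv i x p) (mk⇔ reflect preserve)
      where
      shifted : ∀ {c} → IsDist J (inj₂ (v i)) t c →
                ∀ {z d} → IsDist (G i) z (u i) d → IsDist J (embed i z) t (c + d)
      shifted {c} dc {d = d} dz = subst (IsDist J _ t) (+-comm d c) (IsDist-cut i out dz dc)

      reflect : MaxDistFrom J (embed i x) t → MaxDistFrom (G i) x (u i)
      reflect M = ¬¬-MaxDistFrom (G i) λ ¬M → distJ (inj₂ (v i)) t λ (c , dc) →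
        ¬M (MaxDistFrom-reflect (G i) J (embed i) c (shifted dc) (Adj-embed i) M)

      preserve : MaxDistFrom (G i) x (u i) → MaxDistFrom J (embed i x) t
      preserve M = ¬¬-MaxDistFrom J λ ¬M → distJ (inj₂ (v i)) t λ (c , dc) →
        ¬M (MaxDistFrom-preserve (G i) J (embed i) c (shifted dc)
                                 (λ z → distG i z (u i)) (neighbour-embed i x p) M)

    MaxDistFrom-H-H : ∀ {a b} → NotV (inj₂ a) →
      MaxDistFrom J (inj₂ a) (inj₂ b) ⇔ MaxDistFrom H a b
    MaxDistFrom-H-H {b = b} notV =
      mk⇔ (MaxDistFrom-reflect H J inj₂ 0 IsDist-embedH hh)
          (MaxDistFrom-preserve H J inj₂ 0 IsDist-embedH (λ z → distH z b) (neighbour-H notV))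

    MaxDistFrom-H-G : ∀ j {a y} .{q} → NotV (inj₂ a) →
      MaxDistFrom J (inj₂ a) (inj₁ (gv j y q)) ⇔ MaxDistFrom H a (v j)
    MaxDistFrom-H-G j {a} {y} {q} notV =
      subst (λ s → MaxDistFrom J (inj₂ a) s ⇔ _) (embed-gv j y q) (mk⇔ reflect preserve)
      where
      reflect : MaxDistFrom J (inj₂ a) (embed j y) → MaxDistFrom H a (v j)
      reflect M = ¬¬-MaxDistFrom H λ ¬M → distG j y (u j) λ (c , dc) →
        ¬M (MaxDistFrom-reflect H J inj₂ c (IsDist-cutH j dc) hh M)

      preserve : MaxDistFrom H a (v j) → MaxDistFrom J (inj₂ a) (embed j y)
      preserve M = ¬¬-MaxDistFrom J λ ¬M → distG j y (u j) λ (c , dc) →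
        ¬M (MaxDistFrom-preserve H J inj₂ c (IsDist-cutH j dc)
                                 (λ z → distH z (v j)) (neighbour-H notV) M)

    Cond⇒MutMaxDist : ∀ {w₁ w₂} → NotV w₁ → NotV w₂ → Cond w₁ w₂ → MutMaxDist J w₁ w₂
    Cond⇒MutMaxDist _ _ (c1 (M₁ , M₂)) =
      from (MaxDistFrom-G-G _) M₁ , from (MaxDistFrom-G-G _) M₂
    Cond⇒MutMaxDist notV₁ notV₂ (c2 (M₁ , M₂)) =
      from (MaxDistFrom-H-H notV₁) M₁ , from (MaxDistFrom-H-H notV₂) M₂
    Cond⇒MutMaxDist _ _ (c3 {i} {j} {x} {y} {px} {py} i<j M₁ M₂) =
      from (MaxDistFrom-G-outside i (Outside-gv i j y py (≢-sym (<⇒≢ i<j)))) M₁ ,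
      from (MaxDistFrom-G-outside j (Outside-gv j i x px (<⇒≢ i<j))) M₂
    Cond⇒MutMaxDist _ notV₂ (c4 {i} {b = b} M₁ M₂) =
      from (MaxDistFrom-G-outside i (Outside-H i b)) M₁ , from (MaxDistFrom-H-G i notV₂) M₂

    module NontrivialFactors (nontrivial-G : ∀ i → 2 ≤ n i) (nontrivial-H : 2 ≤ m) where

      v-not-MaxDistFrom-outside : ∀ i {t} → Outside i t → ¬ MaxDistFrom J (inj₂ (v i)) t
      v-not-MaxDistFrom-outside i {t} out M =
        let y , e = Connected⇒neighbour (G i) (nontrivial-G i) (conn-G i) (u i) in
        distJ (inj₂ (v i)) t λ (c , dc) → distG i y (u i) λ (d , dy) →
        M (embed i y) (subst (λ s → AdjJ s (embed i y)) (embed-u i) (Adj-embed i e))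
          (IsDist-cut i out dy dc) dc (m<n+m c (IsDist-pos (G i) (Adj⇒≢ (G i) e) dy))

      v-not-MaxDistFrom-inside : ∀ i y → ¬ MaxDistFrom J (inj₂ (v i)) (embed i y)
      v-not-MaxDistFrom-inside i y M =
        let c , e = Connected⇒neighbour H nontrivial-H conn-H (v i) in
        distG i y (u i) λ (d₁ , dy) → distH c (v i) λ (d₂ , dc) →
        M (inj₂ c) (hh e) (IsDist-cutH i dy dc) (IsDist-cutH i dy (IsDist-refl H))
          (+-monoʳ-< d₁ (IsDist-pos H (Adj⇒≢ H e) dc))

      MaxDistFrom⇒NotV : ∀ w t → MaxDistFrom J w t → NotV w
      MaxDistFrom⇒NotV (inj₁ _) _ _ = tt
      MaxDistFrom⇒NotV (inj₂ _) (inj₂ b) M i refl =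
        v-not-MaxDistFrom-outside i (Outside-H i b) M
      MaxDistFrom⇒NotV (inj₂ _) (inj₁ (gv j y q)) M i refl with j ≟ i
      ... | yes refl =
        v-not-MaxDistFrom-inside i y (subst (MaxDistFrom J _) (≡-sym (embed-gv i y q)) M)
      ... | no j≢i = v-not-MaxDistFrom-outside i (Outside-gv i j y q j≢i) M

      MutMaxDist-G-G : ∀ {i j x y} .{p q} → i ≢ j →
        MutMaxDist J (inj₁ (gv i x p)) (inj₁ (gv j y q)) →
        MaxDistFrom (G i) x (u i) × MaxDistFrom (G j) y (u j)
      MutMaxDist-G-G {i} {j} {x} {y} {p} {q} i≢j (M₁ , M₂) =
        to (MaxDistFrom-G-outside i (Outside-gv i j y q (≢-sym i≢j))) M₁ ,
        to (MaxDistFrom-G-outside j (Outside-gv j i x p i≢j)) M₂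

      MutMaxDist-G-H : ∀ {i x b} .{p} → MutMaxDist J (inj₁ (gv i x p)) (inj₂ b) →
                       Cond (inj₁ (gv i x p)) (inj₂ b)
      MutMaxDist-G-H {i} {b = b} (M₁ , M₂) =
        c4 (to (MaxDistFrom-G-outside i (Outside-H i b)) M₁)
           (to (MaxDistFrom-H-G i (MaxDistFrom⇒NotV _ _ M₂)) M₂)

      MutMaxDist⇒Cond : ∀ w₁ w₂ → MutMaxDist J w₁ w₂ → Cond w₁ w₂ ⊎ Cond w₂ w₁
      MutMaxDist⇒Cond (inj₁ (gv i x p)) (inj₁ (gv j y q)) M with <-cmp i j
      ... | tri≈ _ refl _ =
        inj₁ (c1 (to (MaxDistFrom-G-G i) (proj₁ M) , to (MaxDistFrom-G-G i) (proj₂ M)))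
      ... | tri< i<j i≢j _ = let Mx , My = MutMaxDist-G-G i≢j M in inj₁ (c3 i<j Mx My)
      ... | tri> _ i≢j j<i = let Mx , My = MutMaxDist-G-G i≢j M in inj₂ (c3 j<i My Mx)
      MutMaxDist⇒Cond (inj₁ _) (inj₂ _) M         = inj₁ (MutMaxDist-G-H M)
      MutMaxDist⇒Cond (inj₂ _) (inj₁ _) (M₁ , M₂) = inj₂ (MutMaxDist-G-H (M₂ , M₁))
      MutMaxDist⇒Cond (inj₂ _) (inj₂ _) (M₁ , M₂) =
        inj₁ (c2 (to (MaxDistFrom-H-H (MaxDistFrom⇒NotV _ _ M₁)) M₁ ,
                  to (MaxDistFrom-H-H (MaxDistFrom⇒NotV _ _ M₂)) M₂))

theorem1 : (k : ℕ) → 1 ≤ k →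
    (n : Fin k → ℕ) (G : (i : Fin k) → Graph (Fin (n i))) →
    (∀ i → 2 ≤ n i) → (∀ i → Connected (G i)) →
    (m : ℕ) (H : Graph (Fin m)) → 2 ≤ m → Connected H →
    (u : (i : Fin k) → Fin (n i)) (v : Fin k → Fin m) →
    (w₁ w₂ : VJ n u m) → w₁ ≢ w₂ →
    SREdge (Compose.J G H u v) w₁ w₂
      ⇔ (Compose.NotV G H u v w₁ × Compose.NotV G H u v w₂ ×
         (Compose.Cond G H u v w₁ w₂ ⊎ Compose.Cond G H u v w₂ w₁))
theorem1 _ _ _ G nontrivial-G conn-G _ H nontrivial-H conn-H u v w₁ w₂ w₁≢w₂ = mk⇔
  (λ (_ , M₁ , M₂) → MaxDistFrom⇒NotV w₁ w₂ M₁ , MaxDistFrom⇒NotV w₂ w₁ M₂ ,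
                     MutMaxDist⇒Cond w₁ w₂ (M₁ , M₂))
  λ { (notV₁ , notV₂ , inj₁ c) → w₁≢w₂ , Cond⇒MutMaxDist notV₁ notV₂ c
    ; (notV₁ , notV₂ , inj₂ c) → w₁≢w₂ , swap (Cond⇒MutMaxDist notV₂ notV₁ c) }
  where
  open Composition G H u v
  open ConnectedFactors conn-G conn-H
  open NontrivialFactors nontrivial-G nontrivial-H
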